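{- For every DN formula $\varphi$ there exists an equivalent EDML formula $\varphi'$ with $|\varphi'|=O(|\varphi|)$.
   Context: Graphs are finite, simple, vertex-colored (unary relation symbols $\mathbf P$ interpreted as subsets $\mathbf P(G)\subseteq V(G)$). $N^r(v)=\{u\ne v:\mathrm{dist}_G(u,v)\le r\}$; $N^r_d(U)=\{v:|N^r(v)\cap U|\ge d\}$ for $d,r\in\mathbb N^+$. Formulas have only set variables free. $|\cdot|$ denotes formula length (number of symbols, each number counting as one). DN logic: existential MSO over graphs (quantification over vertices and vertex sets; atomic $E(x,y)$, $x=y$, $x\in X$, $\mathbf P(x)$; only existential quantifiers; negation only of quantifier-free formulas) extended by size measurements $|t|=m,|t|\le m,|t|\ge m$ and comparisons $t_1=t_2$, $t_1\subseteq t_2$, $t_1\supseteq t_2$ of neighborhood terms, which are built from set variables, unary relation symbols and $\emptyset$ by complement, $\cap$, $\cup$, $\setminus$ and $N^r_d(\cdot)$. EDML: set variables $X$ and unary relation symbols $\mathbf P$ are unfinished inner formulas; for unfinished $\psi$ and $d,r\in\mathbb N^+$, $\square^r_d\psi$ is unfinished and $\rangle\square_d\psi$ is finished; $|X|\le m$, $|X|\ge m$ are finished; negations/conjunctions of unfinished (finished) formulas are unfinished (finished); EDML formulas are finished inner formulas and $\exists X\,\psi$ for $\psi$ finished or an EDML formula. Unfinished formulas are evaluated at an active vertex $v$: $X$ holds iff $v\in\beta(X)$, $\mathbf P$ iff $v\in\mathbf P(G)$, $\square^r_d\psi$ iff at least $d$ vertices $w\in N^r(v)$ satisfy $\psi$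 at $w$; $\rangle\square_d\psi$ holds iff at least $d$ vertices of $G$ satisfy $\psi$; the rest is as usual. Two formulas are equivalent if they have the same truth value for every graph and every assignment of vertex sets to the free set variables. -}

module Defs where

open import Data.Nat using (ℕ; zero; suc; _+_; _*_; _≤_; _<_; _≤ᵇ_; _≡ᵇ_)
open import Data.Fin using (Fin; zero; suc)
open import Data.Fin.Properties using (_≟_)
open import Data.Bool using (Bool; true; false; _∧_; _∨_; not; if_then_else_)
open import Relation.Nullary.Decidable using (⌊_⌋)
open import Relation.Binary.PropositionalEquality using (_≡_)

VSet : ℕ → Set
VSet n = Fin n → Bool

cons : ∀ {A : Set} {n} → A → (Fin n → A) → Fin (suc n) → A
cons a f zero    = a
cons a f (suc i) = f i

anyFin : ∀ n → (Fin n → Bool) → Bool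
anyFin zero    f = false
anyFin (suc n) f = f zero ∨ anyFin n (λ i → f (suc i))

allFin : ∀ n → (Fin n → Bool) → Bool
allFin zero    f = true
allFin (suc n) f = f zero ∧ allFin n (λ i → f (suc i))

card : ∀ n → VSet n → ℕ
card zero    S = 0
card (suc n) S = (if S zero then 1 else 0) + card n (λ i → S (suc i))

anySet : ∀ n → (VSet n → Bool) → Bool
anySet zero    F = F (λ ())
anySet (suc n) F = anySet n (λ S → F (cons true S)) ∨ anySet n (λ S → F (cons false S))

record Graph : Set where
  field
    n      : ℕ
    adj    : Fin n → Fin n → Bool
    sym    : ∀ u v → adj u v ≡ adj v u
    irrefl : ∀ v → adj v v ≡ false
    -- interpretation P_i(G) of the unary relation symbol P_i
    col    : ℕ → VSet n

module _ (G : Graph) where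
  open Graph G

  within : ℕ → Fin n → Fin n → Bool
  within zero    u v = ⌊ u ≟ v ⌋
  within (suc r) u v = within r u v ∨ anyFin n (λ w → within r u w ∧ adj w v)

  Nbhd : ℕ → Fin n → VSet n
  Nbhd r v u = not ⌊ u ≟ v ⌋ ∧ within r v u

  Nrd : ℕ → ℕ → VSet n → VSet n
  Nrd d r U v = d ≤ᵇ card n (λ u → Nbhd r v u ∧ U u)

SetAssign : Graph → Set
SetAssign G = ℕ → VSet (Graph.n G)

update : ∀ {G} → SetAssign G → ℕ → VSet (Graph.n G) → SetAssign G
update β X S Y = if X ≡ᵇ Y then S else β Y

data Term : Set where
  tvar  : ℕ → Term
  trel  : ℕ → Term
  tempty : Term
  tcompl : Term → Term
  _t∩_ _t∪_ _t∖_ : Term → Term → Term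
  tN    : (d r : ℕ) → 0 < d → 0 < r → Term → Term

-- quantifier-free formulas with k vertex variables in scope (de Bruijn, Fin k)
data QF (k : ℕ) : Set where
  qE     : Fin k → Fin k → QF k
  qEq    : Fin k → Fin k → QF k
  qMem   : Fin k → ℕ → QF k
  qRel   : ℕ → Fin k → QF k
  qSizeEq qSizeLe qSizeGe : Term → ℕ → QF k
  qTEq qTSub qTSup : Term → Term → QF k
  qNot   : QF k → QF k
  qAnd qOr : QF k → QF k → QF k

data DN (k : ℕ) : Set where
  dQF   : QF k → DN k
  dAnd dOr : DN k → DN k → DN k
  dExV  : DN (suc k) → DN k            -- ∃x (binds vertex variable 0)
  dExS  : ℕ → DN k → DN k

module _ (G : Graph) where
  open Graph G

  evalT : SetAssign G → Term → VSet n
  evalT β (tvar i)     = β i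
  evalT β (trel i)     = col i
  evalT β tempty       = λ _ → false
  evalT β (tcompl t)   = λ v → not (evalT β t v)
  evalT β (t t∩ s)     = λ v → evalT β t v ∧ evalT β s v
  evalT β (t t∪ s)     = λ v → evalT β t v ∨ evalT β s v
  evalT β (t t∖ s)     = λ v → evalT β t v ∧ not (evalT β s v)
  evalT β (tN d r _ _ t) = Nrd G d r (evalT β t)

  subsetᵇ : VSet n → VSet n → Bool
  subsetᵇ A B = allFin n (λ v → not (A v) ∨ B v)

  evalQF : ∀ {k} → SetAssign G → (Fin k → Fin n) → QF k → Bool
  evalQF β ρ (qE x y)      = adj (ρ x) (ρ y)
  evalQF β ρ (qEq x y)     = ⌊ ρ x ≟ ρ y ⌋
  evalQF β ρ (qMem x i)    = β i (ρ x)
  evalQF β ρ (qRel i x)    = col i (ρ x)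
  evalQF β ρ (qSizeEq t m) = card n (evalT β t) ≡ᵇ m
  evalQF β ρ (qSizeLe t m) = card n (evalT β t) ≤ᵇ m
  evalQF β ρ (qSizeGe t m) = m ≤ᵇ card n (evalT β t)
  evalQF β ρ (qTEq t s)    = subsetᵇ (evalT β t) (evalT β s) ∧ subsetᵇ (evalT β s) (evalT β t)
  evalQF β ρ (qTSub t s)   = subsetᵇ (evalT β t) (evalT β s)
  evalQF β ρ (qTSup t s)   = subsetᵇ (evalT β s) (evalT β t)
  evalQF β ρ (qNot φ)      = not (evalQF β ρ φ)
  evalQF β ρ (qAnd φ ψ)    = evalQF β ρ φ ∧ evalQF β ρ ψ
  evalQF β ρ (qOr φ ψ)     = evalQF β ρ φ ∨ evalQF β ρ ψ

  evalDN : ∀ {k} → SetAssign G → (Fin k → Fin n) → DN k → Bool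
  evalDN β ρ (dQF φ)    = evalQF β ρ φ
  evalDN β ρ (dAnd φ ψ) = evalDN β ρ φ ∧ evalDN β ρ ψ
  evalDN β ρ (dOr φ ψ)  = evalDN β ρ φ ∨ evalDN β ρ ψ
  evalDN β ρ (dExV φ)   = anyFin n (λ w → evalDN β (cons w ρ) φ)
  evalDN β ρ (dExS i φ) = anySet n (λ S → evalDN (update {G} β i S) ρ φ)

-- closed (w.r.t. vertex variables) DN formulas: only set variables free
DNFormula : Set
DNFormula = DN 0

noVertices : ∀ {n} → Fin 0 → Fin n
noVertices ()

evalDNFormula : (G : Graph) → SetAssign G → DNFormula → Bool
evalDNFormula G β φ = evalDN G β noVertices φ

data Unf : Set where
  uvar : ℕ → Unf
  urel : ℕ → Unf
  ubox : (d r : ℕ) → 0 < d → 0 < r → Unf → Unf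
  uNot : Unf → Unf
  uAnd : Unf → Unf → Unf

data Fin' : Set where
  fCount : (d : ℕ) → 0 < d → Unf → Fin'
  fCardLe fCardGe : ℕ → ℕ → Fin'
  fNot : Fin' → Fin'
  fAnd : Fin' → Fin' → Fin'

data EDML : Set where
  eFin : Fin' → EDML
  eEx  : ℕ → EDML → EDML

module _ (G : Graph) where
  open Graph G

  evalU : SetAssign G → Unf → VSet n
  evalU β (uvar i) v         = β i v
  evalU β (urel i) v         = col i v
  evalU β (ubox d r _ _ ψ) v = d ≤ᵇ card n (λ w → Nbhd G r v w ∧ evalU β ψ w)
  evalU β (uNot ψ) v         = not (evalU β ψ v)
  evalU β (uAnd ψ χ) v       = evalU β ψ v ∧ evalU β χ v

  evalF : SetAssign G → Fin' → Bool
  evalF β (fCount d _ ψ) = d ≤ᵇ card n (evalU β ψ)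
  evalF β (fCardLe i m)  = card n (β i) ≤ᵇ m
  evalF β (fCardGe i m)  = m ≤ᵇ card n (β i)
  evalF β (fNot φ)       = not (evalF β φ)
  evalF β (fAnd φ ψ)     = evalF β φ ∧ evalF β ψ

  evalE : SetAssign G → EDML → Bool
  evalE β (eFin φ)   = evalF β φ
  evalE β (eEx i φ)  = anySet n (λ S → evalE (update {G} β i S) φ)

-- Formula length: number of symbols, each number / variable / relation
-- symbol counting as one symbol.

lenT : Term → ℕ
lenT (tvar _)       = 1
lenT (trel _)       = 1
lenT tempty         = 1
lenT (tcompl t)     = 1 + lenT t
lenT (t t∩ s)       = 1 + lenT t + lenT s
lenT (t t∪ s)       = 1 + lenT t + lenT s
lenT (t t∖ s)       = 1 + lenT t + lenT s
lenT (tN _ _ _ _ t) = 3 + lenT t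

lenQF : ∀ {k} → QF k → ℕ
lenQF (qE _ _)      = 3
lenQF (qEq _ _)     = 3
lenQF (qMem _ _)    = 3
lenQF (qRel _ _)    = 2
lenQF (qSizeEq t _) = 2 + lenT t
lenQF (qSizeLe t _) = 2 + lenT t
lenQF (qSizeGe t _) = 2 + lenT t
lenQF (qTEq t s)    = 1 + lenT t + lenT s
lenQF (qTSub t s)   = 1 + lenT t + lenT s
lenQF (qTSup t s)   = 1 + lenT t + lenT s
lenQF (qNot φ)      = 1 + lenQF φ
lenQF (qAnd φ ψ)    = 1 + lenQF φ + lenQF ψ
lenQF (qOr φ ψ)     = 1 + lenQF φ + lenQF ψ

lenDN : ∀ {k} → DN k → ℕ
lenDN (dQF φ)    = lenQF φ
lenDN (dAnd φ ψ) = 1 + lenDN φ + lenDN ψ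
lenDN (dOr φ ψ)  = 1 + lenDN φ + lenDN ψ
lenDN (dExV φ)   = 2 + lenDN φ
lenDN (dExS _ φ) = 2 + lenDN φ

lenU : Unf → ℕ
lenU (uvar _)         = 1
lenU (urel _)         = 1
lenU (ubox _ _ _ _ ψ) = 3 + lenU ψ
lenU (uNot ψ)         = 1 + lenU ψ
lenU (uAnd ψ χ)       = 1 + lenU ψ + lenU χ

lenF : Fin' → ℕ
lenF (fCount _ _ ψ) = 2 + lenU ψ
lenF (fCardLe _ _)  = 3
lenF (fCardGe _ _)  = 3
lenF (fNot φ)       = 1 + lenF φ
lenF (fAnd φ ψ)     = 1 + lenF φ + lenF ψ

lenE : EDML → ℕ
lenE (eFin φ)  = lenF φ
lenE (eEx _ φ) = 2 + lenE φ

{-# OPTIONS --safe #-}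
-- A DN formula is brought into prenex form.  A vertex variable x becomes a
-- set variable X constrained to be a singleton, so that an atom about x reads
-- "the vertex of X satisfies ψ", i.e. ⟩□₁(X ∧ ψ); a neighborhood term becomes
-- the unfinished formula defining its characteristic function, and size and
-- inclusion atoms become counting formulas.  Quantifiers are pulled to the
-- front after renaming every bound variable to a fresh one, the fresh names
-- of a subformula forming a contiguous block: since a matrix only mentions
-- names below the end of its own block, the existential prefix of a
-- conjunct (or disjunct) can be moved over the other one.  Every DN symbol
-- produces a bounded number of EDML symbols, whence the linear size bound.
module Submission where

open import Defs
open import Algebra.Core using (Op₂)
open import Data.Bool using (Bool; true; false; _∧_; _∨_; not; if_then_else_)
open import Data.Bool.Properties using (∧-comm; ∧-inverseʳ; ∧-distribˡ-∨; ∧-distribʳ-∨; ∨-identityʳ)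
open import Data.Fin using (Fin; zero; suc)
open import Data.Fin.Properties using (_≟_)
open import Data.Nat using (ℕ; zero; suc; _+_; _*_; _⊔_; _≤_; _<_; _≤ᵇ_; _<ᵇ_; _≡ᵇ_; s≤s; z<s)
open import Data.Nat.Properties
  using (≤-refl; ≤-trans; ≤-reflexive; ≤ᵇ⇒≤; m≤m+n; +-suc; +-assoc; +-mono-≤; +-monoˡ-≤; +-monoʳ-≤; *-monoˡ-≤;
         *-distribˡ-+; *-distribʳ-+; +-comm; +-identityʳ; module ≤-Reasoning; m≤n⇒m≤1+n; m⊔n≤o⇒m≤o; m⊔n≤o⇒n≤o)
open import Data.Nat.Tactic.RingSolver using (solve-∀)
open import Data.Product using (Σ; _×_; _,_)
open import Data.Unit using (⊤; tt)
open import Function using (id; flip)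
open import Relation.Binary.PropositionalEquality
  using (_≡_; refl; sym; trans; cong; cong₂; _≗_; module ≡-Reasoning)
open import Algebra.Definitions {A = Bool} _≡_ using (_DistributesOverˡ_; _DistributesOverʳ_)
open import Relation.Nullary using (yes; no; contradiction)
open import Relation.Nullary.Decidable using (⌊_⌋)

∨-distribʳ-∨ : _∨_ DistributesOverʳ _∨_
∨-distribʳ-∨ x     true  z     = refl
∨-distribʳ-∨ false false z     = refl
∨-distribʳ-∨ true  false true  = refl
∨-distribʳ-∨ true  false false = refl

∨-distribˡ-∨ : _∨_ DistributesOverˡ _∨_
∨-distribˡ-∨ true  y z = refl
∨-distribˡ-∨ false y z = refl

not-∧-not : ∀ x y → not (not x ∧ not y) ≡ x ∨ y
not-∧-not true  y     = refl
not-∧-not false true  = refl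
not-∧-not false false = refl

not-∧-not-right : ∀ x y → not (x ∧ not y) ≡ not x ∨ y
not-∧-not-right true  true  = refl
not-∧-not-right true  false = refl
not-∧-not-right false y     = refl

not-<ᵇ : ∀ m n → not (m <ᵇ n) ≡ (n ≤ᵇ m)
not-<ᵇ zero    zero    = refl
not-<ᵇ zero    (suc n) = refl
not-<ᵇ (suc m) zero    = refl
not-<ᵇ (suc m) (suc n) = trans (not-<ᵇ m n) (sym (≤ᵇ-suc n m))
  where
  ≤ᵇ-suc : ∀ n m → (suc n ≤ᵇ suc m) ≡ (n ≤ᵇ m)
  ≤ᵇ-suc zero    m = refl
  ≤ᵇ-suc (suc n) m = refl

≤ᵇ-∧-≥ᵇ : ∀ m n → ((m ≤ᵇ n) ∧ (n ≤ᵇ m)) ≡ (m ≡ᵇ n)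
≤ᵇ-∧-≥ᵇ zero    zero    = refl
≤ᵇ-∧-≥ᵇ zero    (suc n) = refl
≤ᵇ-∧-≥ᵇ (suc m) zero    = refl
≤ᵇ-∧-≥ᵇ (suc m) (suc n) = trans (cong₂ _∧_ (<ᵇ-suc m n) (<ᵇ-suc n m)) (≤ᵇ-∧-≥ᵇ m n)
  where
  <ᵇ-suc : ∀ m n → (m <ᵇ suc n) ≡ (m ≤ᵇ n)
  <ᵇ-suc zero    n = refl
  <ᵇ-suc (suc m) n = refl

≡ᵇ-refl : ∀ n → (n ≡ᵇ n) ≡ true
≡ᵇ-refl zero    = refl
≡ᵇ-refl (suc n) = ≡ᵇ-refl n

<⇒≡ᵇ-false : ∀ {j c} → j < c → (c ≡ᵇ j) ≡ false
<⇒≡ᵇ-false {zero}  {suc c} _         = refl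
<⇒≡ᵇ-false {suc j} {suc c} (s≤s j<c) = <⇒≡ᵇ-false j<c

+-mono-≤-scaled : ∀ q j x {k a} → k ≤ q * j → a ≤ q * x → k + a ≤ q * (j + x)
+-mono-≤-scaled q j x k≤ a≤ = ≤-trans (+-mono-≤ k≤ a≤) (≤-reflexive (sym (*-distribˡ-+ q j x)))

+-mono-≤-scaled₂ : ∀ q j x y {k a b} → k ≤ q * j → a ≤ q * x → b ≤ q * y → k + a + b ≤ q * (j + x + y)
+-mono-≤-scaled₂ q j x y k≤ a≤ b≤ = +-mono-≤-scaled q (j + x) y (+-mono-≤-scaled q j x k≤ a≤) b≤

singleton : ∀ {m} → Fin m → VSet m
singleton a w = ⌊ w ≟ a ⌋

≟-sym : ∀ {m} (a b : Fin m) → ⌊ a ≟ b ⌋ ≡ ⌊ b ≟ a ⌋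
≟-sym a b with a ≟ b | b ≟ a
... | yes _   | yes _   = refl
... | yes a≡b | no  b≢a = contradiction (sym a≡b) b≢a
... | no  a≢b | yes b≡a = contradiction (sym b≡a) a≢b
... | no  _   | no  _   = refl

≟-suc : ∀ {m} (a b : Fin m) → ⌊ suc a ≟ suc b ⌋ ≡ ⌊ a ≟ b ⌋
≟-suc a b with a ≟ b
... | yes _ = refl
... | no  _ = refl

card-cong : ∀ m {f g : VSet m} → f ≗ g → card m f ≡ card m g
card-cong zero    f≗g = refl
card-cong (suc m) f≗g =
  cong₂ _+_ (cong (λ b → if b then 1 else 0) (f≗g zero)) (card-cong m (λ v → f≗g (suc v)))

card-∅ : ∀ m → card m (λ _ → false) ≡ 0
card-∅ zero    = refl
card-∅ (suc m) = card-∅ m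

allFin-cong : ∀ m {f g : VSet m} → f ≗ g → allFin m f ≡ allFin m g
allFin-cong zero    f≗g = refl
allFin-cong (suc m) f≗g = cong₂ _∧_ (f≗g zero) (allFin-cong m (λ v → f≗g (suc v)))

anyFin-cong : ∀ m {f g : VSet m} → f ≗ g → anyFin m f ≡ anyFin m g
anyFin-cong zero    f≗g = refl
anyFin-cong (suc m) f≗g = cong₂ _∨_ (f≗g zero) (anyFin-cong m (λ v → f≗g (suc v)))

anyFin-∅ : ∀ m {f : VSet m} → f ≗ (λ _ → false) → anyFin m f ≡ false
anyFin-∅ zero    f≗∅ = refl
anyFin-∅ (suc m) f≗∅ = cong₂ _∨_ (f≗∅ zero) (anyFin-∅ m (λ v → f≗∅ (suc v)))

not-anyFin : ∀ m (f : VSet m) → not (anyFin m f) ≡ allFin m (λ v → not (f v))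
not-anyFin zero    f = refl
not-anyFin (suc m) f with f zero
... | true  = refl
... | false = not-anyFin m (λ v → f (suc v))

1≤ᵇcard : ∀ m (f : VSet m) → (1 ≤ᵇ card m f) ≡ anyFin m f
1≤ᵇcard zero    f = refl
1≤ᵇcard (suc m) f with f zero
... | true  = refl
... | false = 1≤ᵇcard m (λ v → f (suc v))

anyFin-singleton : ∀ m {a : Fin m} (S P : VSet m) →
                   S ≗ singleton a → anyFin m (λ w → S w ∧ P w) ≡ P a
anyFin-singleton (suc m) {zero} S P S≗ =
  trans (cong₂ _∨_ (cong (_∧ P zero) (S≗ zero))
                   (anyFin-∅ m (λ w → cong (_∧ P (suc w)) (S≗ (suc w)))))
        (∨-identityʳ (P zero))
anyFin-singleton (suc m) {suc a} S P S≗ =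
  trans (cong (_∨ anyFin m (λ w → S (suc w) ∧ P (suc w))) (cong (_∧ P zero) (S≗ zero)))
        (anyFin-singleton m (λ w → S (suc w)) (λ w → P (suc w))
                          (λ w → trans (S≗ (suc w)) (≟-suc w a)))

anySet-cong : ∀ m {F H : VSet m → Bool} → (∀ S → F S ≡ H S) → anySet m F ≡ anySet m H
anySet-cong zero    F≗H = F≗H _
anySet-cong (suc m) F≗H =
  cong₂ _∨_ (anySet-cong m (λ S → F≗H (cons true S))) (anySet-cong m (λ S → F≗H (cons false S)))

anySet-∅ : ∀ m → anySet m (λ _ → false) ≡ false
anySet-∅ zero    = refl
anySet-∅ (suc m) = cong₂ _∨_ (anySet-∅ m) (anySet-∅ m)

anySet-distribʳ : ∀ (_⊕_ : Op₂ Bool) → _⊕_ DistributesOverʳ _∨_ →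
                  ∀ m (F : VSet m → Bool) x → anySet m (λ S → F S ⊕ x) ≡ anySet m F ⊕ x
anySet-distribʳ _⊕_ distrib zero    F x = refl
anySet-distribʳ _⊕_ distrib (suc m) F x =
  trans (cong₂ _∨_ (anySet-distribʳ _⊕_ distrib m _ x) (anySet-distribʳ _⊕_ distrib m _ x))
        (sym (distrib x _ _))

anySet-empty : ∀ m (F : VSet m → Bool) {b} → (∀ {S} → S ≗ (λ _ → false) → F S ≡ b) →
               anySet m (λ S → (card m S <ᵇ 1) ∧ F S) ≡ b
anySet-empty zero    F F∅ = F∅ (λ ())
anySet-empty (suc m) F F∅ =
  cong₂ _∨_ (anySet-∅ m)
            (anySet-empty m (λ S → F (cons false S))
                          (λ S≗∅ → F∅ (λ { zero → refl ; (suc v) → S≗∅ v })))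

anySet-singleton : ∀ m (F : VSet m → Bool) (H : Fin m → Bool) →
                   (∀ w {S} → S ≗ singleton w → F S ≡ H w) →
                   anySet m (λ S → ((1 ≤ᵇ card m S) ∧ (card m S ≤ᵇ 1)) ∧ F S) ≡ anyFin m H
anySet-singleton zero    F H F≡H = refl
anySet-singleton (suc m) F H F≡H =
  cong₂ _∨_
    (anySet-empty m (λ S → F (cons true S))
       (λ S≗∅ → F≡H zero (λ { zero → refl ; (suc v) → S≗∅ v })))
    (anySet-singleton m (λ S → F (cons false S)) (λ w → H (suc w))
       (λ w S≗ → F≡H (suc w) (λ { zero → refl ; (suc v) → trans (S≗ v) (sym (≟-suc v w)) })))

Nbhd-1 : ∀ G (u v : Fin (Graph.n G)) → Nbhd G 1 u v ≡ Graph.adj G u v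
Nbhd-1 G u v =
  trans (cong (λ b → not ⌊ v ≟ u ⌋ ∧ (⌊ u ≟ v ⌋ ∨ b))
              (anyFin-singleton n (λ w → ⌊ u ≟ w ⌋) (λ w → adj w v) (≟-sym u)))
        distinct∧adj
  where
  open Graph G using (n; adj; irrefl)
  distinct∧adj : (not ⌊ v ≟ u ⌋ ∧ (⌊ u ≟ v ⌋ ∨ adj u v)) ≡ adj u v
  distinct∧adj with u ≟ v | v ≟ u
  ... | yes refl | yes _   = sym (irrefl u)
  ... | yes u≡v  | no  v≢u = contradiction (sym u≡v) v≢u
  ... | no  u≢v  | yes v≡u = contradiction (sym v≡u) u≢v
  ... | no  _    | no  _   = refl

uFalse : Unf
uFalse = uAnd (urel 0) (uNot (urel 0))

uOr : Unf → Unf → Unf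
uOr ψ χ = uNot (uAnd (uNot ψ) (uNot χ))

fTrue : Fin'
fTrue = fNot (fCount 1 z<s uFalse)

fOr : Fin' → Fin' → Fin'
fOr φ ψ = fNot (fAnd (fNot φ) (fNot ψ))

holdsAt : ℕ → Unf → Fin'
holdsAt a ψ = fCount 1 z<s (uAnd (uvar a) ψ)

atLeast : ℕ → Unf → Fin'
atLeast zero    ψ = fTrue
atLeast (suc m) ψ = fCount (suc m) z<s ψ

atMost : ℕ → Unf → Fin'
atMost m ψ = fNot (fCount (suc m) z<s ψ)

included : Unf → Unf → Fin'
included ψ χ = fNot (fCount 1 z<s (uAnd ψ (uNot χ)))

isSingleton : ℕ → Fin'
isSingleton a = fAnd (fCardGe a 1) (fCardLe a 1)

translateT : (ℕ → ℕ) → Term → Unf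
translateT σ (tvar i)           = uvar (σ i)
translateT σ (trel i)           = urel i
translateT σ tempty             = uFalse
translateT σ (tcompl t)         = uNot (translateT σ t)
translateT σ (t t∩ u)           = uAnd (translateT σ t) (translateT σ u)
translateT σ (t t∪ u)           = uOr (translateT σ t) (translateT σ u)
translateT σ (t t∖ u)           = uAnd (translateT σ t) (uNot (translateT σ u))
translateT σ (tN d r d>0 r>0 t) = ubox d r d>0 r>0 (translateT σ t)

-- Set variable i is renamed to setName i, vertex variable x is represented
-- by the singleton set variable vertexName x, and bound variables receive
-- the names fresh, fresh + 1, …
record Scope (k : ℕ) : Set where
  field
    setName    : ℕ → ℕ
    vertexName : Fin k → ℕ
    fresh      : ℕ
open Scope

topScope : ℕ → Scope 0
topScope N = record { setName = id ; vertexName = λ () ; fresh = N }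

skip : ∀ {k} → ℕ → Scope k → Scope k
skip a s = record s { fresh = fresh s + a }

bindVertex : ∀ {k} → Scope k → Scope (suc k)
bindVertex s = record
  { setName = setName s ; vertexName = cons (fresh s) (vertexName s) ; fresh = suc (fresh s) }

bindSet : ∀ {k} → ℕ → Scope k → Scope k
bindSet i s = record s
  { setName = λ j → if i ≡ᵇ j then fresh s else setName s j ; fresh = suc (fresh s) }

translateQF : ∀ {k} → Scope k → QF k → Fin'
translateQF s (qE x y)      = holdsAt (vertexName s x) (ubox 1 1 z<s z<s (uvar (vertexName s y)))
translateQF s (qEq x y)     = holdsAt (vertexName s x) (uvar (vertexName s y))
translateQF s (qMem x i)    = holdsAt (vertexName s x) (uvar (setName s i))
translateQF s (qRel i x)    = holdsAt (vertexName s x) (urel i)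
translateQF s (qSizeEq t m) = fAnd (atMost m (translateT (setName s) t)) (atLeast m (translateT (setName s) t))
translateQF s (qSizeLe t m) = atMost m (translateT (setName s) t)
translateQF s (qSizeGe t m) = atLeast m (translateT (setName s) t)
translateQF s (qTEq t u)    = fAnd (included (translateT (setName s) t) (translateT (setName s) u))
                                   (included (translateT (setName s) u) (translateT (setName s) t))
translateQF s (qTSub t u)   = included (translateT (setName s) t) (translateT (setName s) u)
translateQF s (qTSup t u)   = included (translateT (setName s) u) (translateT (setName s) t)
translateQF s (qNot φ)      = fNot (translateQF s φ)
translateQF s (qAnd φ ψ)    = fAnd (translateQF s φ) (translateQF s ψ)
translateQF s (qOr φ ψ)     = fOr (translateQF s φ) (translateQF s ψ)

quantifiers : ∀ {k} → DN k → ℕ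
quantifiers (dQF _)    = 0
quantifiers (dAnd φ ψ) = quantifiers φ + quantifiers ψ
quantifiers (dOr φ ψ)  = quantifiers φ + quantifiers ψ
quantifiers (dExV φ)   = suc (quantifiers φ)
quantifiers (dExS _ φ) = suc (quantifiers φ)

matrix : ∀ {k} → Scope k → DN k → Fin'
matrix s (dQF φ)    = translateQF s φ
matrix s (dAnd φ ψ) = fAnd (matrix s φ) (matrix (skip (quantifiers φ) s) ψ)
matrix s (dOr φ ψ)  = fOr (matrix s φ) (matrix (skip (quantifiers φ) s) ψ)
matrix s (dExV φ)   = fAnd (isSingleton (fresh s)) (matrix (bindVertex s) φ)
matrix s (dExS i φ) = matrix (bindSet i s) φ

existsBlock : ℕ → ℕ → Fin' → EDML
existsBlock c zero    M = eFin M
existsBlock c (suc k) M = eEx c (existsBlock (suc c) k M)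

prenex : ∀ {k} → Scope k → DN k → EDML
prenex s φ = existsBlock (fresh s) (quantifiers φ) (matrix s φ)

lenU-uOr : ∀ ψ χ → lenU (uOr ψ χ) ≡ 4 + lenU ψ + lenU χ
lenU-uOr ψ χ = cong (3 +_) (+-suc (lenU ψ) (lenU χ))

lenF-fOr : ∀ φ ψ → lenF (fOr φ ψ) ≡ 4 + lenF φ + lenF ψ
lenF-fOr φ ψ = cong (3 +_) (+-suc (lenF φ) (lenF ψ))

lenF-included : ∀ ψ χ → lenF (included ψ χ) ≡ 5 + lenU ψ + lenU χ
lenF-included ψ χ = cong (4 +_) (+-suc (lenU ψ) (lenU χ))

lenF-atLeast : ∀ m ψ → lenF (atLeast m ψ) ≤ 7 + lenU ψ
lenF-atLeast zero    ψ = m≤m+n 7 (lenU ψ)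
lenF-atLeast (suc m) ψ = +-monoˡ-≤ (lenU ψ) (≤ᵇ⇒≤ 2 7 _)

lenE-existsBlock : ∀ c k M → lenE (existsBlock c k M) ≡ k * 2 + lenF M
lenE-existsBlock c zero    M = refl
lenE-existsBlock c (suc k) M = cong (2 +_) (lenE-existsBlock (suc c) k M)

translateT-length : ∀ σ t → lenU (translateT σ t) ≤ 4 * lenT t
translateT-length σ (tvar _)       = ≤ᵇ⇒≤ 1 4 _
translateT-length σ (trel _)       = ≤ᵇ⇒≤ 1 4 _
translateT-length σ tempty         = ≤-refl
translateT-length σ (tcompl t)     = +-mono-≤-scaled 4 1 (lenT t) (≤ᵇ⇒≤ 1 4 _) (translateT-length σ t)
translateT-length σ (t t∩ u)       =
  +-mono-≤-scaled₂ 4 1 (lenT t) (lenT u) (≤ᵇ⇒≤ 1 4 _) (translateT-length σ t) (translateT-length σ u)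
translateT-length σ (t t∪ u)       =
  ≤-trans (≤-reflexive (lenU-uOr (translateT σ t) (translateT σ u)))
          (+-mono-≤-scaled₂ 4 1 (lenT t) (lenT u) ≤-refl (translateT-length σ t) (translateT-length σ u))
translateT-length σ (t t∖ u)       =
  ≤-trans (≤-reflexive (cong suc (+-suc (lenU (translateT σ t)) (lenU (translateT σ u)))))
          (+-mono-≤-scaled₂ 4 1 (lenT t) (lenT u) (≤ᵇ⇒≤ 2 4 _) (translateT-length σ t) (translateT-length σ u))
translateT-length σ (tN _ _ _ _ t) = +-mono-≤-scaled 4 3 (lenT t) (≤ᵇ⇒≤ 3 12 _) (translateT-length σ t)

translateT-length′ : ∀ σ t → lenU (translateT σ t) ≤ 11 * lenT t
translateT-length′ σ t = ≤-trans (translateT-length σ t) (*-monoˡ-≤ (lenT t) (≤ᵇ⇒≤ 4 11 _))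

translateT-length-twice : ∀ σ t → lenU (translateT σ t) + lenU (translateT σ t) ≤ 11 * lenT t
translateT-length-twice σ t =
  ≤-trans (+-mono-≤ (translateT-length σ t) (translateT-length σ t))
          (≤-trans (≤-reflexive (sym (*-distribʳ-+ (lenT t) 4 4))) (*-monoˡ-≤ (lenT t) (≤ᵇ⇒≤ 8 11 _)))

translateQF-length : ∀ {k} (s : Scope k) q → lenF (translateQF s q) ≤ 11 * lenQF q
translateQF-length s (qE _ _)      = ≤ᵇ⇒≤ 8 33 _
translateQF-length s (qEq _ _)     = ≤ᵇ⇒≤ 5 33 _
translateQF-length s (qMem _ _)    = ≤ᵇ⇒≤ 5 33 _
translateQF-length s (qRel _ _)    = ≤ᵇ⇒≤ 5 22 _
translateQF-length s (qSizeEq t m) = begin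
  4 + lenU ψ + lenF (atLeast m ψ) ≤⟨ +-monoʳ-≤ (4 + lenU ψ) (lenF-atLeast m ψ) ⟩
  4 + lenU ψ + (7 + lenU ψ)       ≡⟨ regroup (lenU ψ) ⟩
  11 + (lenU ψ + lenU ψ)          ≤⟨ +-mono-≤-scaled 11 2 (lenT t) (≤ᵇ⇒≤ 11 22 _) (translateT-length-twice (setName s) t) ⟩
  11 * (2 + lenT t)               ∎
  where
  open ≤-Reasoning
  ψ = translateT (setName s) t
  regroup : ∀ a → 4 + a + (7 + a) ≡ 11 + (a + a)
  regroup = solve-∀
translateQF-length s (qSizeLe t m) =
  +-mono-≤-scaled 11 2 (lenT t) (≤ᵇ⇒≤ 3 22 _) (translateT-length′ (setName s) t)
translateQF-length s (qSizeGe t m) =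
  ≤-trans (lenF-atLeast m (translateT (setName s) t))
          (+-mono-≤-scaled 11 2 (lenT t) (≤ᵇ⇒≤ 7 22 _) (translateT-length′ (setName s) t))
translateQF-length s (qTEq t u)    = begin
  1 + lenF (included ψ χ) + lenF (included χ ψ)  ≡⟨ cong₂ (λ a b → 1 + a + b) (lenF-included ψ χ) (lenF-included χ ψ) ⟩
  1 + (5 + lenU ψ + lenU χ) + (5 + lenU χ + lenU ψ) ≡⟨ regroup (lenU ψ) (lenU χ) ⟩
  11 + (lenU ψ + lenU ψ) + (lenU χ + lenU χ)      ≤⟨ +-mono-≤-scaled₂ 11 1 (lenT t) (lenT u) ≤-refl
                                                       (translateT-length-twice (setName s) t)
                                                       (translateT-length-twice (setName s) u) ⟩
  11 * (1 + lenT t + lenT u)                      ∎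
  where
  open ≤-Reasoning
  ψ = translateT (setName s) t
  χ = translateT (setName s) u
  regroup : ∀ a b → 1 + (5 + a + b) + (5 + b + a) ≡ 11 + (a + a) + (b + b)
  regroup = solve-∀
translateQF-length s (qTSub t u)   =
  ≤-trans (≤-reflexive (lenF-included (translateT (setName s) t) (translateT (setName s) u)))
          (+-mono-≤-scaled₂ 11 1 (lenT t) (lenT u) (≤ᵇ⇒≤ 5 11 _)
                            (translateT-length′ (setName s) t) (translateT-length′ (setName s) u))
translateQF-length s (qTSup t u)   =
  ≤-trans (≤-reflexive (trans (lenF-included χ ψ) (cong (5 +_) (+-comm (lenU χ) (lenU ψ)))))
          (+-mono-≤-scaled₂ 11 1 (lenT t) (lenT u) (≤ᵇ⇒≤ 5 11 _)
                            (translateT-length′ (setName s) t) (translateT-length′ (setName s) u))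
  where
  ψ = translateT (setName s) t
  χ = translateT (setName s) u
translateQF-length s (qNot φ)      =
  +-mono-≤-scaled 11 1 (lenQF φ) (≤ᵇ⇒≤ 1 11 _) (translateQF-length s φ)
translateQF-length s (qAnd φ ψ)    =
  +-mono-≤-scaled₂ 11 1 (lenQF φ) (lenQF ψ) (≤ᵇ⇒≤ 1 11 _) (translateQF-length s φ) (translateQF-length s ψ)
translateQF-length s (qOr φ ψ)     =
  ≤-trans (≤-reflexive (lenF-fOr (translateQF s φ) (translateQF s ψ)))
          (+-mono-≤-scaled₂ 11 1 (lenQF φ) (lenQF ψ) (≤ᵇ⇒≤ 4 11 _) (translateQF-length s φ) (translateQF-length s ψ))

matrix-length : ∀ {k} (s : Scope k) φ → quantifiers φ * 2 + lenF (matrix s φ) ≤ 11 * lenDN φ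
matrix-length s (dQF q)    = translateQF-length s q
matrix-length s (dAnd φ ψ) =
  ≤-trans (≤-reflexive (regroup (quantifiers φ) (quantifiers ψ) (lenF (matrix s φ)) (lenF (matrix s′ ψ))))
          (+-mono-≤-scaled₂ 11 1 (lenDN φ) (lenDN ψ) (≤ᵇ⇒≤ 1 11 _) (matrix-length s φ) (matrix-length s′ ψ))
  where
  s′ = skip (quantifiers φ) s
  regroup : ∀ a b m n → (a + b) * 2 + (1 + m + n) ≡ 1 + (a * 2 + m) + (b * 2 + n)
  regroup = solve-∀
matrix-length s (dOr φ ψ)  =
  ≤-trans (≤-reflexive (trans (cong ((quantifiers φ + quantifiers ψ) * 2 +_) (lenF-fOr (matrix s φ) (matrix s′ ψ)))
                              (regroup (quantifiers φ) (quantifiers ψ) (lenF (matrix s φ)) (lenF (matrix s′ ψ)))))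
          (+-mono-≤-scaled₂ 11 1 (lenDN φ) (lenDN ψ) (≤ᵇ⇒≤ 4 11 _) (matrix-length s φ) (matrix-length s′ ψ))
  where
  s′ = skip (quantifiers φ) s
  regroup : ∀ a b m n → (a + b) * 2 + (4 + m + n) ≡ 4 + (a * 2 + m) + (b * 2 + n)
  regroup = solve-∀
matrix-length s (dExV φ)   =
  ≤-trans (≤-reflexive (regroup (quantifiers φ) (lenF (matrix (bindVertex s) φ))))
          (+-mono-≤-scaled 11 2 (lenDN φ) (≤ᵇ⇒≤ 10 22 _) (matrix-length (bindVertex s) φ))
  where
  regroup : ∀ a m → 2 + a * 2 + (8 + m) ≡ 10 + (a * 2 + m)
  regroup = solve-∀
matrix-length s (dExS i φ) =
  +-mono-≤-scaled 11 2 (lenDN φ) (≤ᵇ⇒≤ 2 22 _) (matrix-length (bindSet i s) φ)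

prenex-length : ∀ {k} (s : Scope k) φ → lenE (prenex s φ) ≤ 11 * lenDN φ
prenex-length s φ =
  ≤-trans (≤-reflexive (lenE-existsBlock (fresh s) (quantifiers φ) (matrix s φ))) (matrix-length s φ)

setVarBoundT : Term → ℕ
setVarBoundT (tvar i)       = suc i
setVarBoundT (trel _)       = 0
setVarBoundT tempty         = 0
setVarBoundT (tcompl t)     = setVarBoundT t
setVarBoundT (t t∩ u)       = setVarBoundT t ⊔ setVarBoundT u
setVarBoundT (t t∪ u)       = setVarBoundT t ⊔ setVarBoundT u
setVarBoundT (t t∖ u)       = setVarBoundT t ⊔ setVarBoundT u
setVarBoundT (tN _ _ _ _ t) = setVarBoundT t

setVarBoundQF : ∀ {k} → QF k → ℕ
setVarBoundQF (qE _ _)      = 0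
setVarBoundQF (qEq _ _)     = 0
setVarBoundQF (qMem _ i)    = suc i
setVarBoundQF (qRel _ _)    = 0
setVarBoundQF (qSizeEq t _) = setVarBoundT t
setVarBoundQF (qSizeLe t _) = setVarBoundT t
setVarBoundQF (qSizeGe t _) = setVarBoundT t
setVarBoundQF (qTEq t u)    = setVarBoundT t ⊔ setVarBoundT u
setVarBoundQF (qTSub t u)   = setVarBoundT t ⊔ setVarBoundT u
setVarBoundQF (qTSup t u)   = setVarBoundT t ⊔ setVarBoundT u
setVarBoundQF (qNot φ)      = setVarBoundQF φ
setVarBoundQF (qAnd φ ψ)    = setVarBoundQF φ ⊔ setVarBoundQF ψ
setVarBoundQF (qOr φ ψ)     = setVarBoundQF φ ⊔ setVarBoundQF ψ

setVarBoundDN : ∀ {k} → DN k → ℕ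
setVarBoundDN (dQF q)    = setVarBoundQF q
setVarBoundDN (dAnd φ ψ) = setVarBoundDN φ ⊔ setVarBoundDN ψ
setVarBoundDN (dOr φ ψ)  = setVarBoundDN φ ⊔ setVarBoundDN ψ
setVarBoundDN (dExV φ)   = setVarBoundDN φ
setVarBoundDN (dExS _ φ) = setVarBoundDN φ

VarsBelowU : ℕ → Unf → Set
VarsBelowU c (uvar i)         = i < c
VarsBelowU c (urel _)         = ⊤
VarsBelowU c (ubox _ _ _ _ ψ) = VarsBelowU c ψ
VarsBelowU c (uNot ψ)         = VarsBelowU c ψ
VarsBelowU c (uAnd ψ χ)       = VarsBelowU c ψ × VarsBelowU c χ

VarsBelowF : ℕ → Fin' → Set
VarsBelowF c (fCount _ _ ψ) = VarsBelowU c ψ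
VarsBelowF c (fCardLe i _)  = i < c
VarsBelowF c (fCardGe i _)  = i < c
VarsBelowF c (fNot φ)       = VarsBelowF c φ
VarsBelowF c (fAnd φ ψ)     = VarsBelowF c φ × VarsBelowF c ψ

record ScopeBelow {k} (N c : ℕ) (s : Scope k) : Set where
  field
    setName<    : ∀ i → i < N → setName s i < c
    vertexName< : ∀ x → vertexName s x < c
open ScopeBelow

ScopeBelow-mono : ∀ {k N c c′} {s : Scope k} → c ≤ c′ → ScopeBelow N c s → ScopeBelow N c′ s
ScopeBelow-mono c≤c′ below = record
  { setName<    = λ i i<N → ≤-trans (setName< below i i<N) c≤c′
  ; vertexName< = λ x → ≤-trans (vertexName< below x) c≤c′
  }

ScopeBelow-skip : ∀ {k N} a {s : Scope k} → ScopeBelow N (fresh s) s → ScopeBelow N (fresh s + a) (skip a s)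
ScopeBelow-skip a {s} below = record
  { setName<    = λ i i<N → ≤-trans (setName< below i i<N) (m≤m+n (fresh s) a)
  ; vertexName< = λ x → ≤-trans (vertexName< below x) (m≤m+n (fresh s) a)
  }

ScopeBelow-bindVertex : ∀ {k N} {s : Scope k} → ScopeBelow N (fresh s) s →
                        ScopeBelow N (suc (fresh s)) (bindVertex s)
ScopeBelow-bindVertex below = record
  { setName<    = λ i i<N → m≤n⇒m≤1+n (setName< below i i<N)
  ; vertexName< = λ { zero → ≤-refl ; (suc x) → m≤n⇒m≤1+n (vertexName< below x) }
  }

ScopeBelow-bindSet : ∀ {k N} i {s : Scope k} → ScopeBelow N (fresh s) s →
                     ScopeBelow N (suc (fresh s)) (bindSet i s)
ScopeBelow-bindSet i {s} below = record
  { setName<    = renamed<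
  ; vertexName< = λ x → m≤n⇒m≤1+n (vertexName< below x)
  }
  where
  renamed< : ∀ j → j < _ → setName (bindSet i s) j < suc (fresh s)
  renamed< j j<N with i ≡ᵇ j
  ... | true  = ≤-refl
  ... | false = m≤n⇒m≤1+n (setName< below j j<N)

translateT-varsBelow : ∀ {N c σ} → (∀ i → i < N → σ i < c) →
                       ∀ t → setVarBoundT t ≤ N → VarsBelowU c (translateT σ t)
translateT-varsBelow σ< (tvar i)       i<N = σ< i i<N
translateT-varsBelow σ< (trel _)       _   = tt
translateT-varsBelow σ< tempty         _   = tt , tt
translateT-varsBelow σ< (tcompl t)     ≤N  = translateT-varsBelow σ< t ≤N
translateT-varsBelow σ< (t t∩ u)       ≤N  =
  translateT-varsBelow σ< t (m⊔n≤o⇒m≤o _ _ ≤N) , translateT-varsBelow σ< u (m⊔n≤o⇒n≤o _ _ ≤N)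
translateT-varsBelow σ< (t t∪ u)       ≤N  =
  translateT-varsBelow σ< t (m⊔n≤o⇒m≤o _ _ ≤N) , translateT-varsBelow σ< u (m⊔n≤o⇒n≤o _ _ ≤N)
translateT-varsBelow σ< (t t∖ u)       ≤N  =
  translateT-varsBelow σ< t (m⊔n≤o⇒m≤o _ _ ≤N) , translateT-varsBelow σ< u (m⊔n≤o⇒n≤o _ _ ≤N)
translateT-varsBelow σ< (tN _ _ _ _ t) ≤N  = translateT-varsBelow σ< t ≤N

atLeast-varsBelow : ∀ {c} m ψ → VarsBelowU c ψ → VarsBelowF c (atLeast m ψ)
atLeast-varsBelow zero    ψ _  = tt , tt
atLeast-varsBelow (suc m) ψ ψ< = ψ<

translateQF-varsBelow : ∀ {k N c} {s : Scope k} → ScopeBelow N c s →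
                        ∀ q → setVarBoundQF q ≤ N → VarsBelowF c (translateQF s q)
translateQF-varsBelow below (qE x y)      _   = vertexName< below x , vertexName< below y
translateQF-varsBelow below (qEq x y)     _   = vertexName< below x , vertexName< below y
translateQF-varsBelow below (qMem x i)    i<N = vertexName< below x , setName< below i i<N
translateQF-varsBelow below (qRel i x)    _   = vertexName< below x , tt
translateQF-varsBelow below (qSizeEq t m) ≤N  =
  translateT-varsBelow (setName< below) t ≤N ,
  atLeast-varsBelow m _ (translateT-varsBelow (setName< below) t ≤N)
translateQF-varsBelow below (qSizeLe t m) ≤N  = translateT-varsBelow (setName< below) t ≤N
translateQF-varsBelow below (qSizeGe t m) ≤N  =
  atLeast-varsBelow m _ (translateT-varsBelow (setName< below) t ≤N)
translateQF-varsBelow below (qTEq t u)    ≤N  = (t< , u<) , (u< , t<)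
  where
  t< = translateT-varsBelow (setName< below) t (m⊔n≤o⇒m≤o _ _ ≤N)
  u< = translateT-varsBelow (setName< below) u (m⊔n≤o⇒n≤o _ _ ≤N)
translateQF-varsBelow below (qTSub t u)   ≤N  =
  translateT-varsBelow (setName< below) t (m⊔n≤o⇒m≤o _ _ ≤N) ,
  translateT-varsBelow (setName< below) u (m⊔n≤o⇒n≤o _ _ ≤N)
translateQF-varsBelow below (qTSup t u)   ≤N  =
  translateT-varsBelow (setName< below) u (m⊔n≤o⇒n≤o _ _ ≤N) ,
  translateT-varsBelow (setName< below) t (m⊔n≤o⇒m≤o _ _ ≤N)
translateQF-varsBelow below (qNot φ)      ≤N  = translateQF-varsBelow below φ ≤N
translateQF-varsBelow below (qAnd φ ψ)    ≤N  =
  translateQF-varsBelow below φ (m⊔n≤o⇒m≤o _ _ ≤N) , translateQF-varsBelow below ψ (m⊔n≤o⇒n≤o _ _ ≤N)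
translateQF-varsBelow below (qOr φ ψ)     ≤N  =
  translateQF-varsBelow below φ (m⊔n≤o⇒m≤o _ _ ≤N) , translateQF-varsBelow below ψ (m⊔n≤o⇒n≤o _ _ ≤N)

matrix-varsBelow : ∀ {k N c} {s : Scope k} → ScopeBelow N (fresh s) s →
                   ∀ φ → setVarBoundDN φ ≤ N → fresh s + quantifiers φ ≤ c → VarsBelowF c (matrix s φ)
binary-varsBelow : ∀ {k N c} {s : Scope k} → ScopeBelow N (fresh s) s →
                   ∀ φ ψ → setVarBoundDN φ ⊔ setVarBoundDN ψ ≤ N → fresh s + (quantifiers φ + quantifiers ψ) ≤ c →
                   VarsBelowF c (matrix s φ) × VarsBelowF c (matrix (skip (quantifiers φ) s) ψ)

matrix-varsBelow {s = s} below (dQF q)    ≤N ≤c =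
  translateQF-varsBelow (ScopeBelow-mono (≤-trans (m≤m+n (fresh s) 0) ≤c) below) q ≤N
matrix-varsBelow below (dAnd φ ψ) ≤N ≤c = binary-varsBelow below φ ψ ≤N ≤c
matrix-varsBelow below (dOr φ ψ)  ≤N ≤c = binary-varsBelow below φ ψ ≤N ≤c
matrix-varsBelow {s = s} below (dExV φ)   ≤N ≤c =
  (fresh< , fresh<) , matrix-varsBelow (ScopeBelow-bindVertex below) φ ≤N ≤c′
  where
  ≤c′ : suc (fresh s) + quantifiers φ ≤ _
  ≤c′ = ≤-trans (≤-reflexive (sym (+-suc (fresh s) (quantifiers φ)))) ≤c
  fresh< = ≤-trans (s≤s (m≤m+n (fresh s) (quantifiers φ))) ≤c′
matrix-varsBelow {s = s} below (dExS i φ) ≤N ≤c =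
  matrix-varsBelow (ScopeBelow-bindSet i below) φ ≤N
                   (≤-trans (≤-reflexive (sym (+-suc (fresh s) (quantifiers φ)))) ≤c)

binary-varsBelow {s = s} below φ ψ ≤N ≤c =
  matrix-varsBelow below φ (m⊔n≤o⇒m≤o _ _ ≤N)
                   (≤-trans (+-monoʳ-≤ (fresh s) (m≤m+n (quantifiers φ) (quantifiers ψ))) ≤c) ,
  matrix-varsBelow (ScopeBelow-skip (quantifiers φ) below) ψ (m⊔n≤o⇒n≤o _ _ ≤N)
                   (≤-trans (≤-reflexive (+-assoc (fresh s) (quantifiers φ) (quantifiers ψ))) ≤c)

module Semantics (G : Graph) where
  open Graph G using (n; adj; col)

  update-same : ∀ (γ : SetAssign G) c S → update {G} γ c S c ≗ S
  update-same γ c S v rewrite ≡ᵇ-refl c = refl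

  update-< : ∀ (γ : SetAssign G) {c j} S → j < c → update {G} γ c S j ≗ γ j
  update-< γ S j<c v rewrite <⇒≡ᵇ-false j<c = refl

  Agree : ℕ → SetAssign G → SetAssign G → Set
  Agree c γ γ′ = ∀ j → j < c → γ j ≗ γ′ j

  DependsBelow : ℕ → (SetAssign G → Bool) → Set
  DependsBelow c F = ∀ γ γ′ → Agree c γ γ′ → F γ′ ≡ F γ

  evalU-agree : ∀ {c γ γ′} → Agree c γ γ′ → ∀ ψ → VarsBelowU c ψ → evalU G γ ψ ≗ evalU G γ′ ψ
  evalU-agree agree (uvar i)         i<c        = agree i i<c
  evalU-agree agree (urel _)         _        v = refl
  evalU-agree agree (ubox d r _ _ ψ) ψ<       v =
    cong (d ≤ᵇ_) (card-cong n (λ w → cong (Nbhd G r v w ∧_) (evalU-agree agree ψ ψ< w)))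
  evalU-agree agree (uNot ψ)         ψ<       v = cong not (evalU-agree agree ψ ψ< v)
  evalU-agree agree (uAnd ψ χ)       (ψ< , χ<) v =
    cong₂ _∧_ (evalU-agree agree ψ ψ< v) (evalU-agree agree χ χ< v)

  evalF-agree : ∀ {c γ γ′} → Agree c γ γ′ → ∀ M → VarsBelowF c M → evalF G γ M ≡ evalF G γ′ M
  evalF-agree agree (fCount d _ ψ) ψ<       = cong (d ≤ᵇ_) (card-cong n (evalU-agree agree ψ ψ<))
  evalF-agree agree (fCardLe i m)  i<c      = cong (_≤ᵇ m) (card-cong n (agree i i<c))
  evalF-agree agree (fCardGe i m)  i<c      = cong (m ≤ᵇ_) (card-cong n (agree i i<c))
  evalF-agree agree (fNot M)       M<       = cong not (evalF-agree agree M M<)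
  evalF-agree agree (fAnd M M′)    (M< , M′<) = cong₂ _∧_ (evalF-agree agree M M<) (evalF-agree agree M′ M′<)

  anyBlock : SetAssign G → ℕ → ℕ → (SetAssign G → Bool) → Bool
  anyBlock γ c zero    F = F γ
  anyBlock γ c (suc k) F = anySet n (λ S → anyBlock (update {G} γ c S) (suc c) k F)

  evalE-existsBlock : ∀ γ c k M → evalE G γ (existsBlock c k M) ≡ anyBlock γ c k (λ γ′ → evalF G γ′ M)
  evalE-existsBlock γ c zero    M = refl
  evalE-existsBlock γ c (suc k) M = anySet-cong n (λ S → evalE-existsBlock (update {G} γ c S) (suc c) k M)

  anyBlock-cong : ∀ γ c k {F H : SetAssign G → Bool} → (∀ γ′ → Agree c γ γ′ → F γ′ ≡ H γ′) →
                  anyBlock γ c k F ≡ anyBlock γ c k H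
  anyBlock-cong γ c zero    F≡H = F≡H γ (λ _ _ _ → refl)
  anyBlock-cong γ c (suc k) F≡H = anySet-cong n (λ S → anyBlock-cong (update {G} γ c S) (suc c) k
    (λ γ′ agree → F≡H γ′ (λ j j<c v → trans (sym (update-< γ S j<c v)) (agree j (m≤n⇒m≤1+n j<c) v))))

  anyBlock-+ : ∀ γ c a b F → anyBlock γ c (a + b) F ≡ anyBlock γ c a (λ γ′ → anyBlock γ′ (c + a) b F)
  anyBlock-+ γ c zero    b F = cong (λ d → anyBlock γ d b F) (sym (+-identityʳ c))
  anyBlock-+ γ c (suc a) b F = anySet-cong n (λ S →
    trans (anyBlock-+ (update {G} γ c S) (suc c) a b F)
          (cong (λ d → anyBlock (update {G} γ c S) (suc c) a (λ γ′ → anyBlock γ′ d b F)) (sym (+-suc c a))))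

  anyBlock-distribʳ : ∀ (_⊕_ : Op₂ Bool) → _⊕_ DistributesOverʳ _∨_ →
                      ∀ γ c k (F : SetAssign G → Bool) x → anyBlock γ c k (λ γ′ → F γ′ ⊕ x) ≡ anyBlock γ c k F ⊕ x
  anyBlock-distribʳ _⊕_ distrib γ c zero    F x = refl
  anyBlock-distribʳ _⊕_ distrib γ c (suc k) F x =
    trans (anySet-cong n (λ S → anyBlock-distribʳ _⊕_ distrib (update {G} γ c S) (suc c) k F x))
          (anySet-distribʳ _⊕_ distrib n _ x)

  anyBlock-pullˡ : ∀ (_⊕_ : Op₂ Bool) → _⊕_ DistributesOverˡ _∨_ →
                   ∀ γ c k (F H : SetAssign G → Bool) x → (∀ γ′ → Agree c γ γ′ → F γ′ ≡ x) →
                   anyBlock γ c k (λ γ′ → F γ′ ⊕ H γ′) ≡ x ⊕ anyBlock γ c k H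
  anyBlock-pullˡ _⊕_ distrib γ c k F H x F≡x =
    trans (anyBlock-cong γ c k (λ γ′ agree → cong (_⊕ H γ′) (F≡x γ′ agree)))
          (anyBlock-distribʳ (flip _⊕_) distrib γ c k H x)

  anyBlock-binary : ∀ (_⊕_ : Op₂ Bool) → _⊕_ DistributesOverˡ _∨_ → _⊕_ DistributesOverʳ _∨_ →
                    ∀ γ c a b (F H : SetAssign G → Bool) {x y} → DependsBelow (c + a) F →
                    x ≡ anyBlock γ c a F → (∀ γ₁ → Agree c γ γ₁ → y ≡ anyBlock γ₁ (c + a) b H) →
                    x ⊕ y ≡ anyBlock γ c (a + b) (λ γ′ → F γ′ ⊕ H γ′)
  anyBlock-binary _⊕_ distribˡ distribʳ γ c a b F H {x} {y} F-local x≡ y≡ = begin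
    x ⊕ y                                                  ≡⟨ cong (_⊕ y) x≡ ⟩
    anyBlock γ c a F ⊕ y                                   ≡⟨ anyBlock-distribʳ _⊕_ distribʳ γ c a F y ⟨
    anyBlock γ c a (λ γ₁ → F γ₁ ⊕ y)                        ≡⟨ anyBlock-cong γ c a (λ γ₁ agree → cong (F γ₁ ⊕_) (y≡ γ₁ agree)) ⟩
    anyBlock γ c a (λ γ₁ → F γ₁ ⊕ anyBlock γ₁ (c + a) b H)  ≡⟨ anyBlock-cong γ c a (λ γ₁ _ →
                                                                anyBlock-pullˡ _⊕_ distribˡ γ₁ (c + a) b F H (F γ₁) (F-local γ₁)) ⟨
    anyBlock γ c a (λ γ₁ → anyBlock γ₁ (c + a) b (λ γ₂ → F γ₂ ⊕ H γ₂)) ≡⟨ anyBlock-+ γ c a b _ ⟨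
    anyBlock γ c (a + b) (λ γ′ → F γ′ ⊕ H γ′)               ∎
    where open ≡-Reasoning

  evalU-uFalse : ∀ γ → evalU G γ uFalse ≗ (λ _ → false)
  evalU-uFalse γ v = ∧-inverseʳ (col 0 v)

  evalU-uOr : ∀ γ ψ χ v → evalU G γ (uOr ψ χ) v ≡ evalU G γ ψ v ∨ evalU G γ χ v
  evalU-uOr γ ψ χ v = not-∧-not (evalU G γ ψ v) (evalU G γ χ v)

  evalF-fOr : ∀ γ φ ψ → evalF G γ (fOr φ ψ) ≡ evalF G γ φ ∨ evalF G γ ψ
  evalF-fOr γ φ ψ = not-∧-not (evalF G γ φ) (evalF G γ ψ)

  evalF-atLeast : ∀ γ m ψ → evalF G γ (atLeast m ψ) ≡ (m ≤ᵇ card n (evalU G γ ψ))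
  evalF-atLeast γ zero    ψ = cong (λ k → not (1 ≤ᵇ k)) (trans (card-cong n (evalU-uFalse γ)) (card-∅ n))
  evalF-atLeast γ (suc m) ψ = refl

  evalF-atMost : ∀ γ m ψ → evalF G γ (atMost m ψ) ≡ (card n (evalU G γ ψ) ≤ᵇ m)
  evalF-atMost γ m ψ = not-<ᵇ m (card n (evalU G γ ψ))

  evalF-included : ∀ γ ψ χ {A B} → evalU G γ ψ ≗ A → evalU G γ χ ≗ B →
                   evalF G γ (included ψ χ) ≡ subsetᵇ G A B
  evalF-included γ ψ χ {A} {B} ψ≗A χ≗B =
    trans (cong not (1≤ᵇcard n _))
          (trans (not-anyFin n _)
                 (allFin-cong n (λ v → trans (cong₂ (λ a b → not (a ∧ not b)) (ψ≗A v) (χ≗B v))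
                                             (not-∧-not-right (A v) (B v)))))

  evalF-holdsAt : ∀ γ {a w} ψ → γ a ≗ singleton w → evalF G γ (holdsAt a ψ) ≡ evalU G γ ψ w
  evalF-holdsAt γ {a} ψ γa≗ = trans (1≤ᵇcard n _) (anyFin-singleton n (γ a) (evalU G γ ψ) γa≗)

  evalU-adjacent : ∀ γ {b w} → γ b ≗ singleton w → ∀ v → evalU G γ (ubox 1 1 z<s z<s (uvar b)) v ≡ adj v w
  evalU-adjacent γ {b} {w} γb≗ v =
    trans (1≤ᵇcard n _)
          (trans (anyFin-cong n (λ u → ∧-comm (Nbhd G 1 v u) (γ b u)))
                 (trans (anyFin-singleton n (γ b) (Nbhd G 1 v) γb≗) (Nbhd-1 G v w)))

  translateT-sound : ∀ {N σ β γ} → (∀ i → i < N → γ (σ i) ≗ β i) →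
                     ∀ t → setVarBoundT t ≤ N → evalU G γ (translateT σ t) ≗ evalT G β t
  translateT-sound σ≗ (tvar i)       i<N   = σ≗ i i<N
  translateT-sound σ≗ (trel _)       _   v = refl
  translateT-sound {γ = γ} σ≗ tempty _ = evalU-uFalse γ
  translateT-sound σ≗ (tcompl t)     ≤N  v = cong not (translateT-sound σ≗ t ≤N v)
  translateT-sound σ≗ (t t∩ u)       ≤N  v =
    cong₂ _∧_ (translateT-sound σ≗ t (m⊔n≤o⇒m≤o _ _ ≤N) v) (translateT-sound σ≗ u (m⊔n≤o⇒n≤o _ _ ≤N) v)
  translateT-sound {σ = σ} {γ = γ} σ≗ (t t∪ u) ≤N v =
    trans (evalU-uOr γ (translateT σ t) (translateT σ u) v)
          (cong₂ _∨_ (translateT-sound σ≗ t (m⊔n≤o⇒m≤o _ _ ≤N) v) (translateT-sound σ≗ u (m⊔n≤o⇒n≤o _ _ ≤N) v))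
  translateT-sound σ≗ (t t∖ u)       ≤N  v =
    cong₂ (λ a b → a ∧ not b) (translateT-sound σ≗ t (m⊔n≤o⇒m≤o _ _ ≤N) v)
                              (translateT-sound σ≗ u (m⊔n≤o⇒n≤o _ _ ≤N) v)
  translateT-sound σ≗ (tN d r _ _ t) ≤N  v =
    cong (d ≤ᵇ_) (card-cong n (λ w → cong (Nbhd G r v w ∧_) (translateT-sound σ≗ t ≤N w)))

  record Represents {k} (N : ℕ) (s : Scope k) (β γ : SetAssign G) (ρ : Fin k → Fin n) : Set where
    field
      scopeBelow  : ScopeBelow N (fresh s) s
      setName≗    : ∀ i → i < N → γ (setName s i) ≗ β i
      vertexName≗ : ∀ x → γ (vertexName s x) ≗ singleton (ρ x)
  open Represents

  Represents-top : ∀ N β → Represents N (topScope N) β β noVertices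
  Represents-top N β = record
    { scopeBelow  = record { setName< = λ i i<N → i<N ; vertexName< = λ () }
    ; setName≗    = λ i _ v → refl
    ; vertexName≗ = λ ()
    }

  Represents-skip : ∀ {k N} a {s : Scope k} {β γ γ′ ρ} → Represents N s β γ ρ → Agree (fresh s) γ γ′ →
                    Represents N (skip a s) β γ′ ρ
  Represents-skip a rep agree = record
    { scopeBelow  = ScopeBelow-skip a (scopeBelow rep)
    ; setName≗    = λ i i<N v →
        trans (sym (agree _ (setName< (scopeBelow rep) i i<N) v)) (setName≗ rep i i<N v)
    ; vertexName≗ = λ x v → trans (sym (agree _ (vertexName< (scopeBelow rep) x) v)) (vertexName≗ rep x v)
    }

  Represents-bindVertex : ∀ {k N} {s : Scope k} {β γ ρ S w} → Represents N s β γ ρ → S ≗ singleton w →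
                          Represents N (bindVertex s) β (update {G} γ (fresh s) S) (cons w ρ)
  Represents-bindVertex {s = s} {γ = γ} {S = S} rep S≗ = record
    { scopeBelow  = ScopeBelow-bindVertex (scopeBelow rep)
    ; setName≗    = λ i i<N v →
        trans (update-< γ S (setName< (scopeBelow rep) i i<N) v) (setName≗ rep i i<N v)
    ; vertexName≗ = λ
        { zero v    → trans (update-same γ (fresh s) S v) (S≗ v)
        ; (suc x) v → trans (update-< γ S (vertexName< (scopeBelow rep) x) v) (vertexName≗ rep x v)
        }
    }

  Represents-bindSet : ∀ {k N} i {s : Scope k} {β γ ρ S} → Represents N s β γ ρ →
                       Represents N (bindSet i s) (update {G} β i S) (update {G} γ (fresh s) S) ρ
  Represents-bindSet i {s} {β} {γ} {S = S} rep = record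
    { scopeBelow  = ScopeBelow-bindSet i (scopeBelow rep)
    ; setName≗    = renamed≗
    ; vertexName≗ = λ x v → trans (update-< γ S (vertexName< (scopeBelow rep) x) v) (vertexName≗ rep x v)
    }
    where
    renamed≗ : ∀ j → j < _ → update {G} γ (fresh s) S (setName (bindSet i s) j) ≗ update {G} β i S j
    renamed≗ j j<N v with i ≡ᵇ j
    ... | true  = update-same γ (fresh s) S v
    ... | false = trans (update-< γ S (setName< (scopeBelow rep) j j<N) v) (setName≗ rep j j<N v)

  translateQF-sound : ∀ {k N} {s : Scope k} {β γ ρ} → Represents N s β γ ρ →
                      ∀ q → setVarBoundQF q ≤ N → evalF G γ (translateQF s q) ≡ evalQF G β ρ q
  translateQF-sound {s = s} {γ = γ} {ρ} rep (qE x y) _ =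
    trans (evalF-holdsAt γ (ubox 1 1 z<s z<s (uvar (vertexName s y))) (vertexName≗ rep x))
          (evalU-adjacent γ (vertexName≗ rep y) (ρ x))
  translateQF-sound {s = s} {γ = γ} {ρ} rep (qEq x y) _ =
    trans (evalF-holdsAt γ (uvar (vertexName s y)) (vertexName≗ rep x)) (vertexName≗ rep y (ρ x))
  translateQF-sound {s = s} {γ = γ} {ρ} rep (qMem x i) i<N =
    trans (evalF-holdsAt γ (uvar (setName s i)) (vertexName≗ rep x)) (setName≗ rep i i<N (ρ x))
  translateQF-sound {γ = γ} rep (qRel i x) _ = evalF-holdsAt γ (urel i) (vertexName≗ rep x)
  translateQF-sound {s = s} {γ = γ} rep (qSizeEq t m) ≤N =
    trans (cong₂ _∧_ (evalF-atMost γ m ψ) (evalF-atLeast γ m ψ))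
          (trans (≤ᵇ-∧-≥ᵇ (card n (evalU G γ ψ)) m)
                 (cong (_≡ᵇ m) (card-cong n (translateT-sound (setName≗ rep) t ≤N))))
    where ψ = translateT (setName s) t
  translateQF-sound {s = s} {γ = γ} rep (qSizeLe t m) ≤N =
    trans (evalF-atMost γ m (translateT (setName s) t)) (cong (_≤ᵇ m) (card-cong n (translateT-sound (setName≗ rep) t ≤N)))
  translateQF-sound {s = s} {γ = γ} rep (qSizeGe t m) ≤N =
    trans (evalF-atLeast γ m (translateT (setName s) t)) (cong (m ≤ᵇ_) (card-cong n (translateT-sound (setName≗ rep) t ≤N)))
  translateQF-sound {s = s} {γ = γ} rep (qTEq t u)    ≤N =
    cong₂ _∧_ (evalF-included γ (translateT (setName s) t) (translateT (setName s) u) t≗ u≗)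
              (evalF-included γ (translateT (setName s) u) (translateT (setName s) t) u≗ t≗)
    where
    t≗ = translateT-sound (setName≗ rep) t (m⊔n≤o⇒m≤o _ _ ≤N)
    u≗ = translateT-sound (setName≗ rep) u (m⊔n≤o⇒n≤o _ _ ≤N)
  translateQF-sound {s = s} {γ = γ} rep (qTSub t u)   ≤N =
    evalF-included γ (translateT (setName s) t) (translateT (setName s) u)
                   (translateT-sound (setName≗ rep) t (m⊔n≤o⇒m≤o _ _ ≤N))
                   (translateT-sound (setName≗ rep) u (m⊔n≤o⇒n≤o _ _ ≤N))
  translateQF-sound {s = s} {γ = γ} rep (qTSup t u)   ≤N =
    evalF-included γ (translateT (setName s) u) (translateT (setName s) t)
                   (translateT-sound (setName≗ rep) u (m⊔n≤o⇒n≤o _ _ ≤N))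
                   (translateT-sound (setName≗ rep) t (m⊔n≤o⇒m≤o _ _ ≤N))
  translateQF-sound rep (qNot φ)   ≤N = cong not (translateQF-sound rep φ ≤N)
  translateQF-sound rep (qAnd φ ψ) ≤N =
    cong₂ _∧_ (translateQF-sound rep φ (m⊔n≤o⇒m≤o _ _ ≤N)) (translateQF-sound rep ψ (m⊔n≤o⇒n≤o _ _ ≤N))
  translateQF-sound {s = s} {γ = γ} rep (qOr φ ψ) ≤N =
    trans (evalF-fOr γ (translateQF s φ) (translateQF s ψ))
          (cong₂ _∨_ (translateQF-sound rep φ (m⊔n≤o⇒m≤o _ _ ≤N)) (translateQF-sound rep ψ (m⊔n≤o⇒n≤o _ _ ≤N)))

  matrix-dependsBelow : ∀ {k N} {s : Scope k} {β γ ρ} → Represents N s β γ ρ → ∀ φ → setVarBoundDN φ ≤ N →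
                        DependsBelow (fresh s + quantifiers φ) (λ γ′ → evalF G γ′ (matrix s φ))
  matrix-dependsBelow {s = s} rep φ ≤N γ γ′ agree =
    sym (evalF-agree agree (matrix s φ) (matrix-varsBelow (scopeBelow rep) φ ≤N ≤-refl))

  matrix-sound : ∀ {k N} {s : Scope k} {β γ ρ} → Represents N s β γ ρ → ∀ φ → setVarBoundDN φ ≤ N →
                 evalDN G β ρ φ ≡ anyBlock γ (fresh s) (quantifiers φ) (λ γ′ → evalF G γ′ (matrix s φ))
  matrix-sound rep (dQF q) ≤N = sym (translateQF-sound rep q ≤N)
  matrix-sound {s = s} {γ = γ} rep (dAnd φ ψ) ≤N =
    anyBlock-binary _∧_ ∧-distribˡ-∨ ∧-distribʳ-∨ γ (fresh s) (quantifiers φ) (quantifiers ψ) _ _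
      (matrix-dependsBelow rep φ (m⊔n≤o⇒m≤o _ _ ≤N))
      (matrix-sound rep φ (m⊔n≤o⇒m≤o _ _ ≤N))
      (λ γ₁ agree → matrix-sound (Represents-skip (quantifiers φ) rep agree) ψ (m⊔n≤o⇒n≤o _ _ ≤N))
  matrix-sound {s = s} {γ = γ} rep (dOr φ ψ) ≤N =
    trans (anyBlock-binary _∨_ ∨-distribˡ-∨ ∨-distribʳ-∨ γ (fresh s) (quantifiers φ) (quantifiers ψ) _ _
             (matrix-dependsBelow rep φ (m⊔n≤o⇒m≤o _ _ ≤N))
             (matrix-sound rep φ (m⊔n≤o⇒m≤o _ _ ≤N))
             (λ γ₁ agree → matrix-sound (Represents-skip (quantifiers φ) rep agree) ψ (m⊔n≤o⇒n≤o _ _ ≤N)))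
          (anyBlock-cong γ (fresh s) (quantifiers φ + quantifiers ψ)
             (λ γ′ _ → sym (evalF-fOr γ′ (matrix s φ) (matrix (skip (quantifiers φ) s) ψ))))
  matrix-sound {s = s} {β} {γ} {ρ} rep (dExV φ) ≤N = sym (begin
    anySet n (λ S → anyBlock (γ[c≔ S ]) (suc c) a (λ γ′ → evalF G γ′ (isSingleton c) ∧ evalF G γ′ M))
      ≡⟨ anySet-cong n (λ S → anyBlock-pullˡ _∧_ ∧-distribˡ-∨ (γ[c≔ S ]) (suc c) a _ _ _ (singleton-fixed S)) ⟩
    anySet n (λ S → ((1 ≤ᵇ card n S) ∧ (card n S ≤ᵇ 1)) ∧ anyBlock (γ[c≔ S ]) (suc c) a (λ γ′ → evalF G γ′ M))
      ≡⟨ anySet-singleton n _ _ (λ w S≗ → sym (matrix-sound (Represents-bindVertex rep S≗) φ ≤N)) ⟩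
    anyFin n (λ w → evalDN G β (cons w ρ) φ) ∎)
    where
    open ≡-Reasoning
    c = fresh s
    a = quantifiers φ
    M = matrix (bindVertex s) φ
    γ[c≔_] : VSet n → SetAssign G
    γ[c≔ S ] = update {G} γ c S
    singleton-fixed : ∀ S γ′ → Agree (suc c) (γ[c≔ S ]) γ′ →
                      evalF G γ′ (isSingleton c) ≡ ((1 ≤ᵇ card n S) ∧ (card n S ≤ᵇ 1))
    singleton-fixed S γ′ agree =
      cong (λ k → (1 ≤ᵇ k) ∧ (k ≤ᵇ 1))
           (card-cong n (λ v → trans (sym (agree c ≤-refl v)) (update-same γ c S v)))
  matrix-sound rep (dExS i φ) ≤N = anySet-cong n (λ S → matrix-sound (Represents-bindSet i rep) φ ≤N)

  prenex-sound : ∀ β φ → evalDNFormula G β φ ≡ evalE G β (prenex (topScope (setVarBoundDN φ)) φ)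
  prenex-sound β φ =
    trans (matrix-sound (Represents-top (setVarBoundDN φ) β) φ ≤-refl)
          (sym (evalE-existsBlock β (setVarBoundDN φ) (quantifiers φ) (matrix (topScope (setVarBoundDN φ)) φ)))

lemma7p1 : Σ ℕ λ c → (φ : DNFormula) → Σ EDML λ φ' →
             ((G : Graph) (β : SetAssign G) → evalDNFormula G β φ ≡ evalE G β φ')
             × lenE φ' ≤ c * lenDN φ
lemma7p1 = 11 , λ φ →
  prenex (topScope (setVarBoundDN φ)) φ ,
  (λ G β → Semantics.prenex-sound G β φ) ,
  prenex-length (topScope (setVarBoundDN φ)) φ
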